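{- Let $d,N\geq 1$ and let $\Pi_{d,N}=\Delta_{d-1}\times\cdots\times\Delta_{d-1}\subset\mathbb{R}^{d\times N}$ ($N$ factors). Let $\mathbf{y}\in\mathsf{T}_{d,N}$ be such that the linear functional $\langle\mathbf{y},\cdot\rangle$ takes pairwise distinct values on the vertices of $\Pi_{d,N}$, let $1\leq r\leq d^N$, and let $\ell=(\mathbf{v}_1,\dots,\mathbf{v}_r)$ be the $r$-lineup induced by $\mathbf{y}$. Then the set of elements of the poset $P(d-1,N)$ corresponding to $\mathbf{v}_1,\dots,\mathbf{v}_r$ is an upper order ideal of $P(d-1,N)$.
   Context: $\Delta_{d-1}$ is the simplex in $\mathbb{R}^d$ whose vertices are the standard basis vectors $\mathbf{e}_1,\dots,\mathbf{e}_d$. Coordinates on $\mathbb{R}^{d\times N}$ are $x_{i,j}$ with $i\in[d]$, $j\in[N]$ (the $j$-th factor is the $j$-th copy of $\mathbb{R}^d$). The vertices of $\Pi_{d,N}$ are $\mathbf{e}_{i_1}\times\cdots\times\mathbf{e}_{i_N}$ with $i_1,\dots,i_N\in[d]$; such a vertex is identified with the element $(i_1-1,\dots,i_N-1)$ of $P(d-1,N)=\{0,1,\dots,d-1\}^N$, the Cartesian product of $N$ copies of the chain $0<1<\dots<d-1$ (componentwise order). The test cone is $\mathsf{T}_{d,N}=\{\mathbf{x}\in\mathbb{R}^{d\times N}: 0\leq x_{1,j}\leq x_{2,j}\leq\cdots\leq x_{d,j}\text{ for all } j\in[N]\}$. If $\langle\mathbf{y},\cdot\rangle$ is injective on a finite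 point set $\mathbf{A}$, it totally orders $\mathbf{A}$ from largest to smallest value, and the list of the first $r$ points in this order is the $r$-lineup induced by $\mathbf{y}$. An upper order ideal of a poset is a subset $U$ such that $u\in U$ and $u\leq u'$ imply $u'\in U$. -}

module Defs where

open import Level using (Level; _⊔_) renaming (suc to lsuc)
open import Data.Nat as ℕ using (ℕ; zero; suc)
open import Data.Fin as Fin using (Fin; toℕ)
open import Data.Fin.Properties as FinP using ()
open import Data.List using (List; []; _∷_; concatMap; map; filter; length; allFin)
open import Relation.Binary.PropositionalEquality using (_≡_)
open import Data.Product using (_×_)
open import Data.Sum using (_⊎_)
open import Relation.Nullary using (yes; no)
open import Relation.Binary.Core using (Rel)
open import Relation.Binary.Structures using (IsStrictTotalOrder)
open import Algebra.Bundles using (CommutativeRing)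
import Algebra.Properties.Monoid.Sum as MonoidSum

-- The real numbers ℝ are an instance; we state the theorem for every such
-- ring.
record OrderedCommRing (c ℓ : Level) : Set (lsuc (c ⊔ ℓ)) where
  field
    commRing : CommutativeRing c ℓ
  open CommutativeRing commRing public
  field
    _<_               : Rel Carrier ℓ
    isStrictTotalOrder : IsStrictTotalOrder _≈_ _<_
    +-mono-<          : ∀ {x y} z → x < y → (x + z) < (y + z)
    *-pos             : ∀ {x y} → 0# < x → 0# < y → 0# < (x * y)
    0<1               : 0# < 1#
  open IsStrictTotalOrder isStrictTotalOrder public
    using (_<?_)

  _≤_ : Rel Carrier ℓ
  x ≤ y = (x < y) ⊎ (x ≈ y)

module Setup {c ℓ : Level} (F : OrderedCommRing c ℓ) where
  open OrderedCommRing F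
  open MonoidSum +-monoid using (sum)

  Point : ℕ → ℕ → Set c
  Point d N = Fin d → Fin N → Carrier

  -- Vertices of Π_{d,N} = e_{i_1} × ⋯ × e_{i_N}, encoded by (i_1,…,i_N)
  -- with i_j ∈ Fin d (i.e. already shifted to {0,…,d-1}); this is the
  -- identification with P(d-1,N) = {0,…,d-1}^N.
  Vertex : ℕ → ℕ → Set
  Vertex d N = Fin N → Fin d

  vertexPoint : ∀ {d N} → Vertex d N → Point d N
  vertexPoint v i j with v j Fin.≟ i
  ... | yes _ = 1#
  ... | no  _ = 0#

  ⟨_,_⟩ : ∀ {d N} → Point d N → Point d N → Carrier
  ⟨_,_⟩ {d} {N} y x = sum {d} (λ i → sum {N} (λ j → y i j * x i j))

  InTestCone : ∀ {d N} → Point d N → Set ℓ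
  InTestCone {d} {N} y =
    (∀ (j : Fin N) (i : Fin d) → toℕ i ≡ 0 → 0# ≤ y i j) ×
    (∀ (j : Fin N) (i i′ : Fin d) → toℕ i′ ≡ suc (toℕ i) → y i j ≤ y i′ j)

  InjectiveOnVertices : ∀ {d N} → Point d N → Set ℓ
  InjectiveOnVertices {d} {N} y =
    ∀ (v w : Vertex d N) → ⟨ y , vertexPoint v ⟩ ≈ ⟨ y , vertexPoint w ⟩ →
    ∀ j → v j ≡ w j

  extend : ∀ {d N} → Fin d → Vertex d N → Vertex d (suc N)
  extend a f Fin.zero    = a
  extend a f (Fin.suc j) = f j

  allVertices : ∀ d N → List (Vertex d N)
  allVertices d zero    = (λ ()) ∷ []
  allVertices d (suc N) =
    concatMap (λ a → map (extend a) (allVertices d N)) (allFin d)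

  -- v belongs to the r-lineup induced by y: when the vertices are listed
  -- from largest to smallest value of ⟨y,·⟩, v is among the first r,
  -- i.e. fewer than r vertices w have ⟨y,w⟩ > ⟨y,v⟩.
  InLineup : ∀ {d N} → Point d N → ℕ → Vertex d N → Set
  InLineup {d} {N} y r v =
    length (filter (λ w → ⟨ y , vertexPoint v ⟩ <? ⟨ y , vertexPoint w ⟩)
                   (allVertices d N)) ℕ.< r

_≤P_ : ∀ {d N} → (Fin N → Fin d) → (Fin N → Fin d) → Set
u ≤P u′ = ∀ j → u j Fin.≤ u′ j

IsUpperIdeal : ∀ {p d N} → ((Fin N → Fin d) → Set p) → Set p
IsUpperIdeal {d = d} {N} U = ∀ (u u′ : Fin N → Fin d) → U u → u ≤P u′ → U u′

{-# OPTIONS --safe #-}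

-- On a vertex v of Π_{d,N} the functional reduces to ⟨y, v⟩ = Σ_j y_{v_j, j}.
-- For y in the test cone every column j ↦ y_{i,j} is nondecreasing in i, so
-- ⟨y, ·⟩ is monotone on P(d-1,N). Moving up in P(d-1,N) therefore only
-- shrinks the set of vertices with a strictly larger value, and lying in the
-- r-lineup means that this set has fewer than r elements.

module Submission where

open import Defs
open import Level using (Level)
open import Data.Nat as ℕ using (ℕ; zero; suc)
import Data.Nat.Properties as ℕₚ
open import Data.Fin as Fin using (Fin; toℕ; punchIn)
open import Data.Fin.Properties using (punchInᵢ≢i)
open import Data.List using (filter; length)
open import Data.List.Relation.Binary.Sublist.Propositional using (⊆-refl)
open import Data.List.Relation.Binary.Sublist.Propositional.Properties
  using (filter⁺; length-mono-≤)
open import Data.Empty using (⊥-elim)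
open import Data.Sum using (inj₁; inj₂)
open import Data.Product using (_,_)
open import Function using (_∘_)
open import Relation.Nullary using (yes; no)
open import Relation.Unary using (Pred; Decidable)
open import Relation.Binary.PropositionalEquality as ≡ using (_≡_; _≢_)
open import Algebra.Bundles using (CommutativeMonoid)
import Algebra.Properties.CommutativeMonoid.Sum as CommutativeMonoidSum
import Relation.Binary.Construct.StrictToNonStrict as StrictToNonStrict
import Relation.Binary.Reasoning.Setoid as SetoidReasoning
import Relation.Binary.Reasoning.Preorder as PreorderReasoning
open import Relation.Binary.Bundles using (Preorder)
open import Relation.Binary.Structures using (IsStrictTotalOrder)

length-filter-mono : ∀ {a p q} {A : Set a} {P : Pred A p} {Q : Pred A q}
  (P? : Decidable P) (Q? : Decidable Q) → (∀ {x} → P x → Q x) →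
  ∀ xs → length (filter P? xs) ℕ.≤ length (filter Q? xs)
length-filter-mono P? Q? P⇒Q xs =
  length-mono-≤ (filter⁺ P? Q? (λ { ≡.refl → P⇒Q }) (⊆-refl {x = xs}))

module _ {a ℓ} (M : CommutativeMonoid a ℓ) where
  open CommutativeMonoid M
  open CommutativeMonoidSum M using (sum; sum-remove; sum-cong-≋; sum-replicate-zero)
  open SetoidReasoning setoid

  sum-select : ∀ {n} (t : Fin n → Carrier) (k : Fin n) →
    (∀ i → i ≢ k → t i ≈ ε) → sum t ≈ t k
  sum-select {zero}  t ()
  sum-select {suc n} t k t≈ε = begin
    sum t                                ≈⟨ sum-remove {i = k} t ⟩
    t k ∙ sum (λ i → t (punchIn k i))    ≈⟨ ∙-congˡ (sum-cong-≋ (λ i → t≈ε _ (punchInᵢ≢i k i))) ⟩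
    t k ∙ sum {n} (λ _ → ε)              ≈⟨ ∙-congˡ (sum-replicate-zero n) ⟩
    t k ∙ ε                              ≈⟨ identityʳ (t k) ⟩
    t k                                  ∎

module _ {c ℓ : Level} (F : OrderedCommRing c ℓ) where
  open OrderedCommRing F
  open IsStrictTotalOrder isStrictTotalOrder
    using (isStrictPartialOrder; <-respˡ-≈) renaming (trans to <-trans)
  open Setup F
  open CommutativeMonoidSum +-commutativeMonoid using (sum; ∑-comm; sum-cong-≋)

  ≤-preorder : Preorder c ℓ ℓ
  ≤-preorder = record
    { isPreorder = StrictToNonStrict.isPreorder₂ _≈_ _<_ isStrictPartialOrder }

  open Preorder ≤-preorder using () renaming (trans to ≤-trans)

  ≤-<-trans : ∀ {x y z} → x ≤ y → y < z → x < z
  ≤-<-trans = StrictToNonStrict.≤-<-trans _≈_ _<_ sym <-trans <-respˡ-≈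

  +-monoˡ-≤ : ∀ {x y} z → x ≤ y → (x + z) ≤ (y + z)
  +-monoˡ-≤ z (inj₁ x<y) = inj₁ (+-mono-< z x<y)
  +-monoˡ-≤ z (inj₂ x≈y) = inj₂ (+-congʳ x≈y)

  +-mono-≤ : ∀ {x y u v} → x ≤ y → u ≤ v → (x + u) ≤ (y + v)
  +-mono-≤ {x} {y} {u} {v} x≤y u≤v = begin
    x + u  ∼⟨ +-monoˡ-≤ u x≤y ⟩
    y + u  ≈⟨ +-comm y u ⟩
    u + y  ∼⟨ +-monoˡ-≤ y u≤v ⟩
    v + y  ≈⟨ +-comm v y ⟩
    y + v  ∎
    where open PreorderReasoning ≤-preorder

  sum-mono-≤ : ∀ {n} {f g : Fin n → Carrier} → (∀ i → f i ≤ g i) → sum f ≤ sum g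
  sum-mono-≤ {zero}  f≤g = inj₂ refl
  sum-mono-≤ {suc n} f≤g = +-mono-≤ (f≤g Fin.zero) (sum-mono-≤ (f≤g ∘ Fin.suc))

  monotone-from-successor : ∀ {d} (g : Fin d → Carrier) →
    (∀ i i′ → toℕ i′ ≡ suc (toℕ i) → g i ≤ g i′) →
    ∀ {a b} → a Fin.≤ b → g a ≤ g b
  monotone-from-successor g step {Fin.zero} {Fin.zero} _ = inj₂ refl
  monotone-from-successor {suc (suc d)} g step {Fin.zero} {Fin.suc b} _ =
    ≤-trans (step Fin.zero (Fin.suc Fin.zero) ≡.refl)
            (monotone-from-successor (g ∘ Fin.suc)
              (λ i i′ → step (Fin.suc i) (Fin.suc i′) ∘ ≡.cong suc) {Fin.zero} ℕ.z≤n)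
  monotone-from-successor g step {Fin.suc a} {Fin.suc b} (ℕ.s≤s a≤b) =
    monotone-from-successor (g ∘ Fin.suc)
      (λ i i′ → step (Fin.suc i) (Fin.suc i′) ∘ ≡.cong suc) a≤b

  vertexPoint-diagonal : ∀ {d N} (v : Vertex d N) j → vertexPoint v (v j) j ≈ 1#
  vertexPoint-diagonal v j with v j Fin.≟ v j
  ... | yes _   = refl
  ... | no v≢v = ⊥-elim (v≢v ≡.refl)

  vertexPoint-offDiagonal : ∀ {d N} (v : Vertex d N) {i} j → i ≢ v j →
    vertexPoint v i j ≈ 0#
  vertexPoint-offDiagonal v {i} j i≢v with v j Fin.≟ i
  ... | yes v≡i = ⊥-elim (i≢v (≡.sym v≡i))
  ... | no _    = refl

  ⟨,vertexPoint⟩≈sum : ∀ {d N} (y : Point d N) (v : Vertex d N) →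
    ⟨ y , vertexPoint v ⟩ ≈ sum (λ j → y (v j) j)
  ⟨,vertexPoint⟩≈sum y v = begin
    sum (λ i → sum (λ j → y i j * vertexPoint v i j))  ≈⟨ ∑-comm (λ i j → y i j * vertexPoint v i j) ⟩
    sum (λ j → sum (λ i → y i j * vertexPoint v i j))  ≈⟨ sum-cong-≋ column ⟩
    sum (λ j → y (v j) j)                              ∎
    where
    open SetoidReasoning setoid
    column : ∀ j → sum (λ i → y i j * vertexPoint v i j) ≈ y (v j) j
    column j = begin
      sum (λ i → y i j * vertexPoint v i j)
        ≈⟨ sum-select +-commutativeMonoid _ (v j)
             (λ i i≢v → trans (*-congˡ (vertexPoint-offDiagonal v j i≢v)) (zeroʳ _)) ⟩
      y (v j) j * vertexPoint v (v j) j  ≈⟨ *-congˡ (vertexPoint-diagonal v j) ⟩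
      y (v j) j * 1#                     ≈⟨ *-identityʳ _ ⟩
      y (v j) j                          ∎

  ⟨,vertexPoint⟩-mono : ∀ {d N} (y : Point d N) → InTestCone y →
    ∀ {u u′} → u ≤P u′ → ⟨ y , vertexPoint u ⟩ ≤ ⟨ y , vertexPoint u′ ⟩
  ⟨,vertexPoint⟩-mono y (_ , columns-mono) {u} {u′} u≤u′ = begin
    ⟨ y , vertexPoint u ⟩   ≈⟨ ⟨,vertexPoint⟩≈sum y u ⟩
    sum (λ j → y (u j) j)   ∼⟨ sum-mono-≤ (λ j → monotone-from-successor (λ i → y i j) (columns-mono j) (u≤u′ j)) ⟩
    sum (λ j → y (u′ j) j)  ≈⟨ ⟨,vertexPoint⟩≈sum y u′ ⟨
    ⟨ y , vertexPoint u′ ⟩  ∎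
    where open PreorderReasoning ≤-preorder

  lineup-isUpperIdeal : ∀ {d N} (y : Point d N) (r : ℕ) →
    (∀ {u u′} → u ≤P u′ → ⟨ y , vertexPoint u ⟩ ≤ ⟨ y , vertexPoint u′ ⟩) →
    IsUpperIdeal (InLineup y r)
  lineup-isUpperIdeal {d} {N} y r mono u u′ u∈lineup u≤u′ =
    ℕₚ.≤-<-trans
      (length-filter-mono (λ w → value u′ <? value w) (λ w → value u <? value w)
        (≤-<-trans (mono u≤u′)) (allVertices d N))
      u∈lineup
    where
    value : Vertex d N → Carrier
    value v = ⟨ y , vertexPoint v ⟩

open import Data.Nat using (_≤_; _^_)

mainTheorem1 : ∀ {c ℓ : Level} (F : OrderedCommRing c ℓ) →
    let open Setup F in
    (d N : ℕ) → 1 ≤ d → 1 ≤ N →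
    (y : Point d N) → InTestCone y → InjectiveOnVertices y →
    (r : ℕ) → 1 ≤ r → r ≤ d ^ N →
    IsUpperIdeal (InLineup y r)
mainTheorem1 F d N _ _ y cone _ r _ _ =
  lineup-isUpperIdeal F y r (⟨,vertexPoint⟩-mono F y cone)
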